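{- Let $X$ be a finite set with $|X| = n$ and let $G=(X,W)$ be a monotone simple game on $X$. Let $(V_1,\dots,V_n)$ be a uniformly random permutation of $X$, let $Q(G) = \min\{k : \{V_1,\dots,V_k\} \text{ contains a winning coalition}\}$ (with $Q(G)=n+1$ if no such $k$ exists), and let $\overline{Q}(G) = E[Q(G)]$. Then $$\overline{Q}(G) = n+1 - \sum_{k=0}^{n} \frac{|W_k|}{\binom{n}{k}},$$ where $W_k$ denotes the set of winning coalitions of size $k$.
   Context: A simple game $G=(X,W)$ on a finite set $X$ is a collection $W$ of subsets of $X$ (the winning coalitions) with $\emptyset\notin W$; $W$ may be empty. It is monotone if $A \subseteq B\subseteq X$ and $A\in W$ imply $B \in W$. -}

module Defs where

open import Data.Bool using (Bool; true; false; if_then_else_; _∧_)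
open import Data.Nat using (ℕ; zero; suc; _≡ᵇ_)
open import Data.Nat.Combinatorics using (_C_)
open import Data.Fin using (Fin)
open import Data.Fin.Properties using (_≟_)
open import Data.Fin.Subset using (Subset; ⊥; ⁅_⁆; _∪_; _⊆_; ∣_∣)
open import Data.List using (List; []; _∷_; map; concatMap; filter; foldr; length; take; upTo; allFin)
open import Data.Vec using (Vec; []; _∷_; toList)
open import Data.Integer using (+_)
import Data.Rational as ℚ
open ℚ using (ℚ)
import Data.List.Relation.Unary.Unique.DecPropositional as UniqueDec
open import Relation.Binary.PropositionalEquality using (_≡_)

Family : ℕ → Set
Family n = Subset n → Bool

IsSimpleGame : ∀ {n} → Family n → Set
IsSimpleGame W = W ⊥ ≡ false

IsMonotone : ∀ {n} → Family n → Set
IsMonotone {n} W = ∀ (A B : Subset n) → A ⊆ B → W A ≡ true → W B ≡ true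

allSubsets : (n : ℕ) → List (Subset n)
allSubsets zero = [] ∷ []
allSubsets (suc n) = concatMap (λ s → (true ∷ s) ∷ (false ∷ s) ∷ []) (allSubsets n)

countW : ∀ {n} → Family n → ℕ → ℕ
countW {n} W k = length (filter (λ s → Data.Bool.T? (W s ∧ (∣ s ∣ ≡ᵇ k))) (allSubsets n))
  where import Data.Bool

allSeqs : (n m : ℕ) → List (Vec (Fin n) m)
allSeqs n zero = [] ∷ []
allSeqs n (suc m) = concatMap (λ x → map (x ∷_) (allSeqs n m)) (allFin n)

allPerms : (n : ℕ) → List (Vec (Fin n) n)
allPerms n = filter (λ v → UniqueDec.unique? _≟_ (toList v)) (allSeqs n n)

setOf : ∀ {n} → List (Fin n) → Subset n
setOf = foldr (λ x s → ⁅ x ⁆ ∪ s) ⊥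

Q : ∀ {n} → Family n → Vec (Fin n) n → ℕ
Q {n} W V = foldr (λ k r → if W (setOf (take k (toList V))) then k else r) (suc n) (upTo (suc n))

-- a / d as a rational, with the convention a / 0 = 0 (only used with d > 0)
frac : ℕ → ℕ → ℚ
frac a zero = ℚ.0ℚ
frac a (suc d) = (+ a) ℚ./ suc d

sumℕ : List ℕ → ℕ
sumℕ = foldr Data.Nat._+_ 0
  where import Data.Nat

sumℚ : List ℚ → ℚ
sumℚ = foldr ℚ._+_ ℚ.0ℚ

Qbar : ∀ {n} → Family n → ℚ
Qbar {n} W = frac (sumℕ (map (Q W) (allPerms n))) (length (allPerms n))

rhs : ∀ {n} → Family n → ℚ
rhs {n} W = (+ suc n) ℚ./ 1 ℚ.- sumℚ (map (λ k → frac (countW W k) (n C k)) (upTo (suc n)))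

-- By monotonicity, once a prefix {V₁,…,V_k} of an ordering V wins, all longer prefixes win, so
-- Q(V) is the number of losing prefixes among k = 0,…,n. Summed over the n! orderings, losing and
-- winning prefixes together number (n+1)·n!. A k-set S is the prefix set of exactly k!(n−k)!
-- orderings, hence the winning k-prefixes number |W_k|·k!(n−k)! = n!·|W_k|/C(n,k); dividing by n!
-- gives the formula. The count k!(n−k)! is proved by induction on k for repetition-free sequences
-- avoiding a set T of already used elements.

module Submission where

open import Defs
open import Data.Bool using (Bool; true; false; not; _∧_; _∨_; if_then_else_)
import Data.Bool as 𝔹
import Data.Bool.Properties as Bool
open import Data.Bool.ListAction using (all; and)
open import Data.Nat using (ℕ; zero; suc; _+_; _*_; _∸_; _≤_; _<_; s≤s; _≡ᵇ_; _!; pred)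
open import Data.Nat.Properties
  using ( +-identityʳ; +-suc; *-identityˡ; *-identityʳ; *-zeroʳ; *-comm; *-assoc; *-distribˡ-+
        ; suc-injective; ≤-pred; suc-pred; ≡ᵇ⇒≡; _!≢0; _!*_!≢0; +-commutativeSemigroup)
open import Data.Nat.DivMod using (m/n*n≡m)
open import Data.Nat.Combinatorics using (_C_; nCk≡n!/k![n-k]!; k![n∸k]!∣n!)
open import Data.Nat.ListAction.Properties using (sum-++)
open import Data.Fin using (Fin; zero; suc)
open import Data.Fin.Properties using (_≟_)
open import Data.Fin.Subset using (Subset; ⊥; ⁅_⁆; _∪_; _─_; _-_; ∁; ∣_∣; _⊆_)
open import Data.Fin.Subset.Properties using (∪-identityˡ; p─⊥≡p; ⊆-min; ⊆-refl; x∈p∪q⁺; x∈p∪q⁻)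
import Data.Sum as Sum
open import Data.List using (List; []; _∷_; map; concatMap; filter; foldr; length; take; applyUpTo; upTo; allFin; _++_)
open import Data.List.Properties using (map-cong; map-cong-local; map-∘; map-++; map-tabulate; length-upTo)
import Data.List.Relation.Unary.All as All
open import Data.List.Relation.Unary.All using (all?)
import Data.List.Relation.Unary.Unique.DecPropositional as UniqueDec
open import Data.List.Membership.Propositional.Properties using (∈-upTo⁻)
open import Data.Vec using (Vec; []; _∷_; lookup; toList)
open import Data.Vec.Properties using (lookup-zipWith; lookup-replicate; lookup-map; ≡-dec)
import Data.Integer as ℤ
import Data.Integer.Properties as ℤ
import Data.Rational as ℚ
open ℚ using (ℚ)
import Data.Rational.Properties as ℚ
import Data.Rational.Unnormalised as ℚᵘ
open ℚᵘ using (mkℚᵘ; *≡*)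
import Data.Rational.Unnormalised.Properties as ℚᵘ
open import Function using (_∘_; mk⇔)
open import Relation.Nullary using (does; ¬?; contradiction)
open import Relation.Nullary.Decidable using (dec-true; dec-false; does-⇔)
open import Relation.Unary using (Pred; Decidable)
open import Relation.Binary using (DecidableEquality)
open import Relation.Binary.PropositionalEquality using (_≡_; _≢_; refl; sym; trans; cong; cong₂; module ≡-Reasoning)
open import Algebra.Bundles using (CommutativeMonoid)
open import Algebra.Properties.CommutativeSemigroup +-commutativeSemigroup
  using () renaming (interchange to +-interchange)
open import Algebra.Properties.CommutativeSemigroup (CommutativeMonoid.commutativeSemigroup Bool.∧-commutativeMonoid)
  using () renaming (interchange to ∧-interchange)

private
  variable
    A B : Set
    n : ℕ

∑ : {A : Set} → List A → (A → ℕ) → ℕ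
∑ xs f = sumℕ (map f xs)

syntax ∑ xs (λ x → e) = ∑[ x ∈ xs ] e

𝟙 : Bool → ℕ
𝟙 true = 1
𝟙 false = 0

∑-cong : ∀ {f g : A → ℕ} xs → (∀ x → f x ≡ g x) → ∑ xs f ≡ ∑ xs g
∑-cong xs f≗g = cong sumℕ (map-cong f≗g xs)

∑-const : ∀ c (xs : List A) → ∑[ _ ∈ xs ] c ≡ length xs * c
∑-const c [] = refl
∑-const c (x ∷ xs) = cong (c +_) (∑-const c xs)

∑-zero : ∀ (xs : List A) → ∑[ _ ∈ xs ] 0 ≡ 0
∑-zero xs = trans (∑-const 0 xs) (*-zeroʳ (length xs))

∑-++ : ∀ (f : A → ℕ) xs ys → ∑ (xs ++ ys) f ≡ ∑ xs f + ∑ ys f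
∑-++ f xs ys = trans (cong sumℕ (map-++ f xs ys)) (sum-++ (map f xs) (map f ys))

∑-+ : ∀ (f g : A → ℕ) xs → ∑[ x ∈ xs ] (f x + g x) ≡ ∑ xs f + ∑ xs g
∑-+ f g [] = refl
∑-+ f g (x ∷ xs) = trans (cong (f x + g x +_) (∑-+ f g xs)) (+-interchange (f x) (g x) _ _)

∑-*ˡ : ∀ c (f : A → ℕ) xs → ∑[ x ∈ xs ] (c * f x) ≡ c * ∑ xs f
∑-*ˡ c f [] = sym (*-zeroʳ c)
∑-*ˡ c f (x ∷ xs) = trans (cong (c * f x +_) (∑-*ˡ c f xs)) (sym (*-distribˡ-+ c (f x) _))

∑-*ʳ : ∀ c (f : A → ℕ) xs → ∑[ x ∈ xs ] (f x * c) ≡ ∑ xs f * c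
∑-*ʳ c f xs = trans (∑-cong xs (λ x → *-comm (f x) c)) (trans (∑-*ˡ c f xs) (*-comm c _))

∑-filter : ∀ {p} {P : Pred A p} (P? : Decidable P) (f : A → ℕ) xs →
         ∑ (filter P? xs) f ≡ ∑[ x ∈ xs ] (𝟙 (does (P? x)) * f x)
∑-filter P? f [] = refl
∑-filter P? f (x ∷ xs) with does (P? x)
... | true  = cong₂ _+_ (sym (+-identityʳ (f x))) (∑-filter P? f xs)
... | false = ∑-filter P? f xs

∑-map : ∀ (f : B → ℕ) (g : A → B) xs → ∑ (map g xs) f ≡ ∑[ x ∈ xs ] f (g x)
∑-map f g xs = cong sumℕ (sym (map-∘ xs))

∑-concatMap : ∀ (f : B → ℕ) (g : A → List B) xs →
              ∑ (concatMap g xs) f ≡ ∑[ x ∈ xs ] ∑ (g x) f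
∑-concatMap f g [] = refl
∑-concatMap f g (x ∷ xs) = trans (∑-++ f (g x) (concatMap g xs)) (cong (∑ (g x) f +_) (∑-concatMap f g xs))

∑-comm : ∀ (h : A → B → ℕ) xs ys → ∑[ x ∈ xs ] ∑[ y ∈ ys ] h x y ≡ ∑[ y ∈ ys ] ∑[ x ∈ xs ] h x y
∑-comm h [] ys = sym (∑-zero ys)
∑-comm h (x ∷ xs) ys = trans (cong (∑ ys (h x) +_) (∑-comm h xs ys)) (sym (∑-+ (h x) _ ys))

∑-allFin-suc : ∀ {n} (f : Fin (suc n) → ℕ) → ∑ (allFin (suc n)) f ≡ f zero + ∑[ x ∈ allFin n ] f (suc x)
∑-allFin-suc f = cong (λ xs → f zero + sumℕ xs)
                      (trans (map-tabulate suc f) (sym (map-tabulate (λ x → x) (f ∘ suc))))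

lookup-⊥ : (y : Fin n) → lookup ⊥ y ≡ false
lookup-⊥ y = lookup-replicate y false

lookup-⁅x⁆ : (x y : Fin n) → lookup ⁅ x ⁆ y ≡ does (x ≟ y)
lookup-⁅x⁆ zero    zero    = refl
lookup-⁅x⁆ zero    (suc y) = lookup-⊥ y
lookup-⁅x⁆ (suc x) zero    = refl
lookup-⁅x⁆ (suc x) (suc y) = lookup-⁅x⁆ x y

lookup-∪ : (p q : Subset n) (y : Fin n) → lookup (p ∪ q) y ≡ lookup p y ∨ lookup q y
lookup-∪ p q y = lookup-zipWith _∨_ y p q

lookup-[⁅x⁆∪p]-x : (x : Fin n) (p : Subset n) → lookup (⁅ x ⁆ ∪ p) x ≡ true
lookup-[⁅x⁆∪p]-x x p =
  trans (lookup-∪ ⁅ x ⁆ p x) (cong (_∨ lookup p x) (trans (lookup-⁅x⁆ x x) (dec-true (x ≟ x) refl)))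

lookup-[⁅x⁆∪p]-y : ∀ {x y : Fin n} (p : Subset n) → y ≢ x → lookup (⁅ x ⁆ ∪ p) y ≡ lookup p y
lookup-[⁅x⁆∪p]-y {x = x} {y} p y≢x =
  trans (lookup-∪ ⁅ x ⁆ p y) (cong (_∨ lookup p y) (trans (lookup-⁅x⁆ x y) (dec-false (x ≟ y) (λ x≡y → y≢x (sym x≡y)))))

lookup-∁ : (p : Subset n) (y : Fin n) → lookup (∁ p) y ≡ not (lookup p y)
lookup-∁ p y = lookup-map y not p

lookup-[p-x]-x : (p : Subset n) (x : Fin n) → lookup (p - x) x ≡ false
lookup-[p-x]-x (b ∷ p) zero    = refl
lookup-[p-x]-x (b ∷ p) (suc x) = lookup-[p-x]-x p x

lookup-[p-x]-y : ∀ (p : Subset n) {x y} → y ≢ x → lookup (p - x) y ≡ lookup p y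
lookup-[p-x]-y (b ∷ p) {zero}  {zero}  y≢x = contradiction refl y≢x
lookup-[p-x]-y (b ∷ p) {zero}  {suc y} y≢x = cong (λ q → lookup q y) (p─⊥≡p p)
lookup-[p-x]-y (b ∷ p) {suc x} {zero}  y≢x = refl
lookup-[p-x]-y (b ∷ p) {suc x} {suc y} y≢x = lookup-[p-x]-y p (λ y≡x → y≢x (cong suc y≡x))

∣p∣≡∑ : ∀ {n} (p : Subset n) → ∣ p ∣ ≡ ∑[ y ∈ allFin n ] 𝟙 (lookup p y)
∣p∣≡∑ []          = refl
∣p∣≡∑ (true ∷ p)  = trans (cong suc (∣p∣≡∑ p)) (sym (∑-allFin-suc (λ y → 𝟙 (lookup (true ∷ p) y))))
∣p∣≡∑ (false ∷ p) = trans (∣p∣≡∑ p) (sym (∑-allFin-suc (λ y → 𝟙 (lookup (false ∷ p) y))))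

∣p∣≡1+∣p-x∣ : (p : Subset n) (x : Fin n) → lookup p x ≡ true → ∣ p ∣ ≡ suc ∣ p - x ∣
∣p∣≡1+∣p-x∣ (true ∷ p)  zero    refl = cong suc (cong ∣_∣ (sym (p─⊥≡p p)))
∣p∣≡1+∣p-x∣ (true ∷ p)  (suc x) x∈p  = cong suc (∣p∣≡1+∣p-x∣ p x x∈p)
∣p∣≡1+∣p-x∣ (false ∷ p) (suc x) x∈p  = ∣p∣≡1+∣p-x∣ p x x∈p

∁[⁅x⁆∪p]≡∁p-x : (x : Fin n) (p : Subset n) → ∁ (⁅ x ⁆ ∪ p) ≡ ∁ p - x
∁[⁅x⁆∪p]≡∁p-x zero    (b ∷ p) = cong (false ∷_) (trans (cong ∁ (∪-identityˡ p)) (sym (p─⊥≡p (∁ p))))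
∁[⁅x⁆∪p]≡∁p-x (suc x) (b ∷ p) = cong (not b ∷_) (∁[⁅x⁆∪p]≡∁p-x x p)

[⁅x⁆∪p]-x≡p : (x : Fin n) (p : Subset n) → lookup p x ≡ false → (⁅ x ⁆ ∪ p) - x ≡ p
[⁅x⁆∪p]-x≡p zero    (false ∷ p) refl = cong (false ∷_) (trans (p─⊥≡p (⊥ ∪ p)) (∪-identityˡ p))
[⁅x⁆∪p]-x≡p (suc x) (b ∷ p)     x∉p  = cong (b ∷_) ([⁅x⁆∪p]-x≡p x p x∉p)

⁅x⁆∪[p-x]≡p : (x : Fin n) (p : Subset n) → lookup p x ≡ true → ⁅ x ⁆ ∪ (p - x) ≡ p
⁅x⁆∪[p-x]≡p zero    (true ∷ p) refl = cong (true ∷_) (trans (∪-identityˡ (p ─ ⊥)) (p─⊥≡p p))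
⁅x⁆∪[p-x]≡p (suc x) (b ∷ p)    x∈p  = cong (b ∷_) (⁅x⁆∪[p-x]≡p x p x∈p)

-- Its `does` computes componentwise on subsets with explicit heads.
infix 4 _≟ₛ_
_≟ₛ_ : DecidableEquality (Subset n)
_≟ₛ_ = ≡-dec Bool._≟_

⁅x⁆∪p≟q≡p≟q-x : ∀ (x : Fin n) p q → lookup p x ≡ false → lookup q x ≡ true →
                does (⁅ x ⁆ ∪ p ≟ₛ q) ≡ does (p ≟ₛ q - x)
⁅x⁆∪p≟q≡p≟q-x x p q x∉p x∈q = does-⇔ (mk⇔ to from) (⁅ x ⁆ ∪ p ≟ₛ q) (p ≟ₛ q - x)
  where
  to : ⁅ x ⁆ ∪ p ≡ q → p ≡ q - x
  to refl = sym ([⁅x⁆∪p]-x≡p x p x∉p)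
  from : p ≡ q - x → ⁅ x ⁆ ∪ p ≡ q
  from refl = ⁅x⁆∪[p-x]≡p x q x∈q

⊥≟p≡∣p∣≡ᵇ0 : (p : Subset n) → does (⊥ ≟ₛ p) ≡ (∣ p ∣ ≡ᵇ 0)
⊥≟p≡∣p∣≡ᵇ0 []          = refl
⊥≟p≡∣p∣≡ᵇ0 (true ∷ p)  = refl
⊥≟p≡∣p∣≡ᵇ0 (false ∷ p) = ⊥≟p≡∣p∣≡ᵇ0 p

∑-allSubsets-≟ : ∀ {n} (p : Subset n) (h : Subset n → ℕ) → ∑[ q ∈ allSubsets n ] (𝟙 (does (p ≟ₛ q)) * h q) ≡ h p
∑-allSubsets-≟ [] h = trans (+-identityʳ _) (+-identityʳ (h []))
∑-allSubsets-≟ {suc n} (b ∷ p) h = begin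
  ∑ (concatMap cons (allSubsets n)) term            ≡⟨ ∑-concatMap term cons (allSubsets n) ⟩
  ∑[ q ∈ allSubsets n ] ∑ (cons q) term             ≡⟨ ∑-cong (allSubsets n) (∑-cons b) ⟩
  ∑[ q ∈ allSubsets n ] (𝟙 (does (p ≟ₛ q)) * h (b ∷ q)) ≡⟨ ∑-allSubsets-≟ p (λ q → h (b ∷ q)) ⟩
  h (b ∷ p)                                          ∎
  where
  open ≡-Reasoning
  cons : Subset n → List (Subset (suc n))
  cons q = (true ∷ q) ∷ (false ∷ q) ∷ []
  term : Subset (suc n) → ℕ
  term q = 𝟙 (does (b ∷ p ≟ₛ q)) * h q
  ∑-cons : ∀ c q → ∑ (cons q) (λ r → 𝟙 (does (c ∷ p ≟ₛ r)) * h r) ≡ 𝟙 (does (p ≟ₛ q)) * h (c ∷ q)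
  ∑-cons true  q = +-identityʳ _
  ∑-cons false q = +-identityʳ _

∣∁p∣≡∑ : ∀ {n} (p : Subset n) → ∣ ∁ p ∣ ≡ ∑[ y ∈ allFin n ] 𝟙 (not (lookup p y))
∣∁p∣≡∑ {n} p = trans (∣p∣≡∑ (∁ p)) (∑-cong (allFin n) (λ y → cong 𝟙 (lookup-∁ p y)))

∣∁p∣≡1+∣∁[⁅x⁆∪p]∣ : (x : Fin n) (p : Subset n) → lookup p x ≡ false → ∣ ∁ p ∣ ≡ suc ∣ ∁ (⁅ x ⁆ ∪ p) ∣
∣∁p∣≡1+∣∁[⁅x⁆∪p]∣ x p x∉p = trans (∣p∣≡1+∣p-x∣ (∁ p) x (trans (lookup-∁ p x) (cong not x∉p)))
                                  (cong (λ q → suc ∣ q ∣) (sym (∁[⁅x⁆∪p]≡∁p-x x p)))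

∣∁⊥∣≡n : ∀ n → ∣ ∁ (⊥ {n}) ∣ ≡ n
∣∁⊥∣≡n zero    = refl
∣∁⊥∣≡n (suc n) = cong suc (∣∁⊥∣≡n n)

isFresh : Subset n → List (Fin n) → Bool
isFresh T []      = true
isFresh T (x ∷ l) = not (lookup T x) ∧ isFresh (⁅ x ⁆ ∪ T) l

not-∨ : ∀ a b → not (a ∨ b) ≡ not a ∧ not b
not-∨ true  b = refl
not-∨ false b = refl

all-∧ : ∀ {A : Set} (f g : A → Bool) xs → all (λ x → f x ∧ g x) xs ≡ all f xs ∧ all g xs
all-∧ f g []       = refl
all-∧ f g (x ∷ xs) = trans (cong ((f x ∧ g x) ∧_) (all-∧ f g xs)) (∧-interchange (f x) (g x) _ _)

does-all? : ∀ (x : Fin n) l → does (all? (λ y → ¬? (x ≟ y)) l) ≡ all (λ y → not (does (x ≟ y))) l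
does-all? x []      = refl
does-all? x (y ∷ l) = cong (not (does (x ≟ y)) ∧_) (does-all? x l)

isFresh≡avoids∧unique : (T : Subset n) (l : List (Fin n)) →
                        isFresh T l ≡ all (not ∘ lookup T) l ∧ does (UniqueDec.unique? _≟_ l)
isFresh≡avoids∧unique T []      = refl
isFresh≡avoids∧unique T (x ∷ l) = begin
  not (lookup T x) ∧ isFresh (⁅ x ⁆ ∪ T) l
    ≡⟨ cong (not (lookup T x) ∧_) (isFresh≡avoids∧unique (⁅ x ⁆ ∪ T) l) ⟩
  a ∧ (all (not ∘ lookup (⁅ x ⁆ ∪ T)) l ∧ u)
    ≡⟨ cong (λ b → a ∧ (b ∧ u)) avoids-⁅x⁆∪T ⟩
  a ∧ ((c ∧ b) ∧ u)
    ≡⟨ cong (λ z → a ∧ (z ∧ u)) (Bool.∧-comm c b) ⟩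
  a ∧ ((b ∧ c) ∧ u)
    ≡⟨ cong (a ∧_) (Bool.∧-assoc b c u) ⟩
  a ∧ (b ∧ (c ∧ u))
    ≡⟨ Bool.∧-assoc a b (c ∧ u) ⟨
  (a ∧ b) ∧ (c ∧ u)
    ≡⟨ cong (λ z → (a ∧ b) ∧ (z ∧ u)) (does-all? x l) ⟨
  all (not ∘ lookup T) (x ∷ l) ∧ does (UniqueDec.unique? _≟_ (x ∷ l)) ∎
  where
  open ≡-Reasoning
  a b c u : Bool
  a = not (lookup T x)
  b = all (not ∘ lookup T) l
  c = all (λ y → not (does (x ≟ y))) l
  u = does (UniqueDec.unique? _≟_ l)
  avoids-⁅x⁆∪T : all (not ∘ lookup (⁅ x ⁆ ∪ T)) l ≡ c ∧ b
  avoids-⁅x⁆∪T = trans (cong and (map-cong ∉⁅x⁆∪T l))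
                       (all-∧ (λ y → not (does (x ≟ y))) (not ∘ lookup T) l)
    where
    ∉⁅x⁆∪T : ∀ y → not (lookup (⁅ x ⁆ ∪ T) y) ≡ not (does (x ≟ y)) ∧ not (lookup T y)
    ∉⁅x⁆∪T y = begin
      not (lookup (⁅ x ⁆ ∪ T) y)            ≡⟨ cong not (lookup-∪ ⁅ x ⁆ T y) ⟩
      not (lookup ⁅ x ⁆ y ∨ lookup T y)     ≡⟨ not-∨ (lookup ⁅ x ⁆ y) (lookup T y) ⟩
      not (lookup ⁅ x ⁆ y) ∧ not (lookup T y) ≡⟨ cong (λ z → not z ∧ not (lookup T y)) (lookup-⁅x⁆ x y) ⟩
      not (does (x ≟ y)) ∧ not (lookup T y) ∎

isFresh⊥≡unique : (l : List (Fin n)) → isFresh ⊥ l ≡ does (UniqueDec.unique? _≟_ l)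
isFresh⊥≡unique l =
  trans (isFresh≡avoids∧unique ⊥ l) (cong (_∧ does (UniqueDec.unique? _≟_ l)) (avoids-⊥ l))
  where
  avoids-⊥ : ∀ l → all (not ∘ lookup ⊥) l ≡ true
  avoids-⊥ []      = refl
  avoids-⊥ (y ∷ l) = cong₂ _∧_ (cong not (lookup-⊥ y)) (avoids-⊥ l)

isFresh⇒setOf-take-avoids : ∀ (T : Subset n) l k {y} → isFresh T l ≡ true → lookup T y ≡ true →
                            lookup (setOf (take k l)) y ≡ false
isFresh⇒setOf-take-avoids T l       zero    {y} _ _ = lookup-⊥ y
isFresh⇒setOf-take-avoids T []      (suc k) {y} _ _ = lookup-⊥ y
isFresh⇒setOf-take-avoids T (x ∷ l) (suc k) {y} fresh y∈T with lookup T x in x∈T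
... | false = begin
  lookup (⁅ x ⁆ ∪ setOf (take k l)) y    ≡⟨ lookup-[⁅x⁆∪p]-y (setOf (take k l)) y≢x ⟩
  lookup (setOf (take k l)) y            ≡⟨ isFresh⇒setOf-take-avoids (⁅ x ⁆ ∪ T) l k fresh y∈⁅x⁆∪T ⟩
  false                                  ∎
  where
  open ≡-Reasoning
  y≢x : y ≢ x
  y≢x refl with trans (sym y∈T) x∈T
  ... | ()
  y∈⁅x⁆∪T : lookup (⁅ x ⁆ ∪ T) y ≡ true
  y∈⁅x⁆∪T = trans (lookup-[⁅x⁆∪p]-y T y≢x) y∈T

prefix : ∀ {m} → ℕ → Vec (Fin n) m → Subset n
prefix k v = setOf (take k (toList v))

∑-allSeqs-suc : ∀ {m} (f : Vec (Fin n) (suc m) → ℕ) →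
                ∑ (allSeqs n (suc m)) f ≡ ∑[ x ∈ allFin n ] ∑[ v ∈ allSeqs n m ] f (x ∷ v)
∑-allSeqs-suc {n} {m} f =
  trans (∑-concatMap f _ (allFin n)) (∑-cong (allFin n) (λ x → ∑-map f (x ∷_) (allSeqs n m)))

𝟙-∧ : ∀ a b → 𝟙 (a ∧ b) ≡ 𝟙 a * 𝟙 b
𝟙-∧ true  b = sym (+-identityʳ (𝟙 b))
𝟙-∧ false b = refl

#fresh : ∀ m (T : Subset n) → ∣ ∁ T ∣ ≡ m → ∑[ v ∈ allSeqs n m ] 𝟙 (isFresh T (toList v)) ≡ m !
#fresh zero    T _ = refl
#fresh {n} (suc m) T ∣∁T∣≡1+m = begin
  ∑[ v ∈ allSeqs n (suc m) ] 𝟙 (isFresh T (toList v))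
    ≡⟨ ∑-allSeqs-suc {n} {m} _ ⟩
  ∑[ x ∈ allFin n ] ∑[ v ∈ allSeqs n m ] 𝟙 (not (lookup T x) ∧ isFresh (⁅ x ⁆ ∪ T) (toList v))
    ≡⟨ ∑-cong (allFin n) startingWith ⟩
  ∑[ x ∈ allFin n ] (𝟙 (not (lookup T x)) * m !)
    ≡⟨ ∑-*ʳ (m !) _ (allFin n) ⟩
  ∑[ x ∈ allFin n ] 𝟙 (not (lookup T x)) * m !
    ≡⟨ cong (_* m !) (trans (sym (∣∁p∣≡∑ T)) ∣∁T∣≡1+m) ⟩
  suc m * m ! ∎
  where
  open ≡-Reasoning
  startingWith : ∀ x → ∑[ v ∈ allSeqs n m ] 𝟙 (not (lookup T x) ∧ isFresh (⁅ x ⁆ ∪ T) (toList v))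
                       ≡ 𝟙 (not (lookup T x)) * m !
  startingWith x with lookup T x in x∈T
  ... | true  = ∑-zero (allSeqs n m)
  ... | false = trans (#fresh m (⁅ x ⁆ ∪ T) ∣∁[⁅x⁆∪T]∣≡m) (sym (+-identityʳ (m !)))
    where
    ∣∁[⁅x⁆∪T]∣≡m : ∣ ∁ (⁅ x ⁆ ∪ T) ∣ ≡ m
    ∣∁[⁅x⁆∪T]∣≡m = suc-injective (trans (sym (∣∁p∣≡1+∣∁[⁅x⁆∪p]∣ x T x∈T)) ∣∁T∣≡1+m)

∧-congˡ-true : ∀ a {b c} → (a ≡ true → b ≡ c) → a ∧ b ≡ a ∧ c
∧-congˡ-true true  b≡c = b≡c refl
∧-congˡ-true false _   = refl

m*[𝟙[m≡ᵇn]*o]≡𝟙[m≡ᵇn]*[n*o] : ∀ m n o → m * (𝟙 (m ≡ᵇ n) * o) ≡ 𝟙 (m ≡ᵇ n) * (n * o)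
m*[𝟙[m≡ᵇn]*o]≡𝟙[m≡ᵇn]*[n*o] m n o with m ≡ᵇ n | ≡ᵇ⇒≡ m n
... | true  | m≡n rewrite m≡n _ = trans (cong (n *_) (*-identityˡ o)) (sym (*-identityˡ (n * o)))
... | false | _   = *-zeroʳ m

Disjoint : Subset n → Subset n → Set
Disjoint S T = ∀ y → lookup S y ≡ true → lookup T y ≡ false

-- For a fresh x ∷ v, its (k+1)-prefix is S iff x ∈ S and the k-prefix of v, which avoids x, is S - x.
#freshWithPrefix : ∀ m k (T S : Subset n) → k ≤ m → ∣ ∁ T ∣ ≡ m → Disjoint S T →
                   ∑[ v ∈ allSeqs n m ] 𝟙 (isFresh T (toList v) ∧ does (prefix k v ≟ₛ S))
                   ≡ 𝟙 (∣ S ∣ ≡ᵇ k) * (k ! * (m ∸ k) !)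
#freshWithPrefix {n} m zero T S _ ∣∁T∣≡m _ = begin
  ∑[ v ∈ allSeqs n m ] 𝟙 (isFresh T (toList v) ∧ does (⊥ ≟ₛ S))
    ≡⟨ ∑-cong (allSeqs n m) (λ v → 𝟙-∧ (isFresh T (toList v)) _) ⟩
  ∑[ v ∈ allSeqs n m ] (𝟙 (isFresh T (toList v)) * 𝟙 (does (⊥ ≟ₛ S)))
    ≡⟨ ∑-*ʳ _ _ (allSeqs n m) ⟩
  ∑[ v ∈ allSeqs n m ] 𝟙 (isFresh T (toList v)) * 𝟙 (does (⊥ ≟ₛ S))
    ≡⟨ cong₂ _*_ (#fresh m T ∣∁T∣≡m) (cong 𝟙 (⊥≟p≡∣p∣≡ᵇ0 S)) ⟩
  m ! * 𝟙 (∣ S ∣ ≡ᵇ 0)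
    ≡⟨ *-comm (m !) _ ⟩
  𝟙 (∣ S ∣ ≡ᵇ 0) * m !
    ≡⟨ cong (𝟙 (∣ S ∣ ≡ᵇ 0) *_) (*-identityˡ (m !)) ⟨
  𝟙 (∣ S ∣ ≡ᵇ 0) * (1 * m !) ∎
  where open ≡-Reasoning
#freshWithPrefix {n} (suc m) (suc k) T S (s≤s k≤m) ∣∁T∣≡1+m S∩T≡∅ = begin
  ∑[ v ∈ allSeqs n (suc m) ] 𝟙 (isFresh T (toList v) ∧ does (prefix (suc k) v ≟ₛ S))
    ≡⟨ ∑-allSeqs-suc {n} {m} _ ⟩
  ∑[ x ∈ allFin n ] ∑[ v ∈ allSeqs n m ] 𝟙 (isFresh T (x ∷ toList v) ∧ does (⁅ x ⁆ ∪ prefix k v ≟ₛ S))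
    ≡⟨ ∑-cong (allFin n) startingWith ⟩
  ∑[ x ∈ allFin n ] (𝟙 (lookup S x) * R)
    ≡⟨ ∑-*ʳ R _ (allFin n) ⟩
  ∑[ x ∈ allFin n ] 𝟙 (lookup S x) * R
    ≡⟨ cong (_* R) (∣p∣≡∑ S) ⟨
  ∣ S ∣ * R
    ≡⟨ m*[𝟙[m≡ᵇn]*o]≡𝟙[m≡ᵇn]*[n*o] ∣ S ∣ (suc k) _ ⟩
  𝟙 (∣ S ∣ ≡ᵇ suc k) * (suc k * (k ! * (m ∸ k) !))
    ≡⟨ cong (𝟙 (∣ S ∣ ≡ᵇ suc k) *_) (*-assoc (suc k) (k !) _) ⟨
  𝟙 (∣ S ∣ ≡ᵇ suc k) * (suc k ! * (m ∸ k) !) ∎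
  where
  open ≡-Reasoning
  R : ℕ
  R = 𝟙 (∣ S ∣ ≡ᵇ suc k) * (k ! * (m ∸ k) !)
  startingWith : ∀ x → ∑[ v ∈ allSeqs n m ] 𝟙 (isFresh T (x ∷ toList v) ∧ does (⁅ x ⁆ ∪ prefix k v ≟ₛ S))
                       ≡ 𝟙 (lookup S x) * R
  startingWith x with lookup S x in x∈S
  ... | false = trans (∑-cong (allSeqs n m) (λ v → cong 𝟙 (trans (cong (_ ∧_) (⁅x⁆∪p≢S (prefix k v)))
                                                                 (Bool.∧-zeroʳ _))))
                      (∑-zero (allSeqs n m))
    where
    ⁅x⁆∪p≢S : ∀ p → does (⁅ x ⁆ ∪ p ≟ₛ S) ≡ false
    ⁅x⁆∪p≢S p = dec-false (⁅ x ⁆ ∪ p ≟ₛ S) (λ ⁅x⁆∪p≡S → true≢false (trans (sym (lookup-[⁅x⁆∪p]-x x p))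
                                                                 (trans (cong (λ q → lookup q x) ⁅x⁆∪p≡S) x∈S)))
      where
      true≢false : true ≢ false
      true≢false ()
  ... | true  = begin
    ∑[ v ∈ allSeqs n m ] 𝟙 ((not (lookup T x) ∧ isFresh T′ (toList v)) ∧ does (⁅ x ⁆ ∪ prefix k v ≟ₛ S))
      ≡⟨ ∑-cong (allSeqs n m) (λ v → cong 𝟙 (removeFirst v)) ⟩
    ∑[ v ∈ allSeqs n m ] 𝟙 (isFresh T′ (toList v) ∧ does (prefix k v ≟ₛ S - x))
      ≡⟨ #freshWithPrefix m k T′ (S - x) k≤m ∣∁T′∣≡m S-x∩T′≡∅ ⟩
    𝟙 (∣ S - x ∣ ≡ᵇ k) * (k ! * (m ∸ k) !)
      ≡⟨ cong (λ s → 𝟙 (s ≡ᵇ suc k) * (k ! * (m ∸ k) !)) (∣p∣≡1+∣p-x∣ S x x∈S) ⟨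
    R
      ≡⟨ *-identityˡ R ⟨
    1 * R ∎
    where
    T′ : Subset n
    T′ = ⁅ x ⁆ ∪ T
    x∉T : lookup T x ≡ false
    x∉T = S∩T≡∅ x x∈S
    ∣∁T′∣≡m : ∣ ∁ T′ ∣ ≡ m
    ∣∁T′∣≡m = suc-injective (trans (sym (∣∁p∣≡1+∣∁[⁅x⁆∪p]∣ x T x∉T)) ∣∁T∣≡1+m)
    removeFirst : ∀ v → (not (lookup T x) ∧ isFresh T′ (toList v)) ∧ does (⁅ x ⁆ ∪ prefix k v ≟ₛ S)
                        ≡ isFresh T′ (toList v) ∧ does (prefix k v ≟ₛ S - x)
    removeFirst v rewrite x∉T = ∧-congˡ-true (isFresh T′ (toList v)) (λ fresh →
      ⁅x⁆∪p≟q≡p≟q-x x (prefix k v) S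
        (isFresh⇒setOf-take-avoids T′ (toList v) k fresh (lookup-[⁅x⁆∪p]-x x T)) x∈S)
    S-x∩T′≡∅ : Disjoint (S - x) T′
    S-x∩T′≡∅ y y∈S-x = trans (lookup-[⁅x⁆∪p]-y T y≢x) (S∩T≡∅ y (trans (sym (lookup-[p-x]-y S y≢x)) y∈S-x))
      where
      y≢x : y ≢ x
      y≢x refl with trans (sym (lookup-[p-x]-x S x)) y∈S-x
      ... | ()

setOf-take-⊆ : ∀ {n} k (l : List (Fin n)) → setOf (take k l) ⊆ setOf (take (suc k) l)
setOf-take-⊆ zero    l       = ⊆-min _
setOf-take-⊆ (suc k) []      = ⊆-refl
setOf-take-⊆ (suc k) (x ∷ l) y∈ = x∈p∪q⁺ (Sum.map₂ (setOf-take-⊆ k l) (x∈p∪q⁻ ⁅ x ⁆ _ y∈))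

module FirstTrue (g : ℕ → Bool) (g-mono : ∀ k → g k ≡ true → g (suc k) ≡ true) where

  firstTrue : List ℕ → ℕ → ℕ
  firstTrue ks default = foldr (λ k r → if g k then k else r) default ks

  g-propagates : ∀ (f : ℕ → ℕ) → (∀ i → f (suc i) ≡ suc (f i)) → g (f 0) ≡ true → ∀ i → g (f i) ≡ true
  g-propagates f f-step g[f0] zero    = g[f0]
  g-propagates f f-step g[f0] (suc i) rewrite f-step i = g-mono (f i) (g-propagates f f-step g[f0] i)

  ∑-not-g≡0 : ∀ m (f : ℕ → ℕ) → (∀ i → g (f i) ≡ true) → ∑[ k ∈ applyUpTo f m ] 𝟙 (not (g k)) ≡ 0
  ∑-not-g≡0 zero    f g∘f = refl
  ∑-not-g≡0 (suc m) f g∘f rewrite g∘f 0 = ∑-not-g≡0 m (λ i → f (suc i)) (λ i → g∘f (suc i))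

  firstTrue≡f0+∑ : ∀ m (f : ℕ → ℕ) → (∀ i → f (suc i) ≡ suc (f i)) →
                   firstTrue (applyUpTo f m) (f m) ≡ f 0 + ∑[ k ∈ applyUpTo f m ] 𝟙 (not (g k))
  firstTrue≡f0+∑ zero    f f-step = sym (+-identityʳ (f 0))
  firstTrue≡f0+∑ (suc m) f f-step with g (f 0) in g[f0]
  ... | true  = sym (trans (cong (f 0 +_) (∑-not-g≡0 m (f ∘ suc) (λ i → g-propagates f f-step g[f0] (suc i))))
                           (+-identityʳ (f 0)))
  ... | false = begin
    firstTrue (applyUpTo f′ m) (f′ m)
      ≡⟨ firstTrue≡f0+∑ m f′ (λ i → f-step (suc i)) ⟩
    f′ 0 + ∑[ k ∈ applyUpTo f′ m ] 𝟙 (not (g k))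
      ≡⟨ cong (_+ ∑[ k ∈ applyUpTo f′ m ] 𝟙 (not (g k))) (f-step 0) ⟩
    suc (f 0) + ∑[ k ∈ applyUpTo f′ m ] 𝟙 (not (g k))
      ≡⟨ +-suc (f 0) _ ⟨
    f 0 + suc (∑[ k ∈ applyUpTo f′ m ] 𝟙 (not (g k))) ∎
    where
    open ≡-Reasoning
    f′ : ℕ → ℕ
    f′ = f ∘ suc

Q≡∑losing : ∀ {n} (W : Family n) → IsMonotone W → (V : Vec (Fin n) n) →
            Q W V ≡ ∑[ k ∈ upTo (suc n) ] 𝟙 (not (W (prefix k V)))
Q≡∑losing {n} W mon V = firstTrue≡f0+∑ (suc n) (λ i → i) (λ i → refl)
  where open FirstTrue (λ k → W (prefix k V)) (λ k → mon _ _ (setOf-take-⊆ k (toList V)))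

∑-allPerms : ∀ n (f : Vec (Fin n) n → ℕ) →
             ∑ (allPerms n) f ≡ ∑[ v ∈ allSeqs n n ] (𝟙 (isFresh ⊥ (toList v)) * f v)
∑-allPerms n f = trans (∑-filter (λ v → UniqueDec.unique? _≟_ (toList v)) f (allSeqs n n))
                         (∑-cong (allSeqs n n) (λ v → cong (λ b → 𝟙 b * f v) (sym (isFresh⊥≡unique (toList v)))))

length-allPerms : ∀ n → length (allPerms n) ≡ n !
length-allPerms n = begin
  length (allPerms n)                                    ≡⟨ *-identityʳ _ ⟨
  length (allPerms n) * 1                                ≡⟨ ∑-const 1 (allPerms n) ⟨
  ∑[ _ ∈ allPerms n ] 1                                  ≡⟨ ∑-allPerms n (λ _ → 1) ⟩
  ∑[ v ∈ allSeqs n n ] (𝟙 (isFresh ⊥ (toList v)) * 1)   ≡⟨ ∑-cong (allSeqs n n) (λ v → *-identityʳ _) ⟩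
  ∑[ v ∈ allSeqs n n ] 𝟙 (isFresh ⊥ (toList v))         ≡⟨ #fresh n ⊥ (∣∁⊥∣≡n n) ⟩
  n !                                                    ∎
  where open ≡-Reasoning

#permsWithPrefix : ∀ {n} k (S : Subset n) → k ≤ n →
                   ∑[ V ∈ allPerms n ] 𝟙 (does (prefix k V ≟ₛ S)) ≡ 𝟙 (∣ S ∣ ≡ᵇ k) * (k ! * (n ∸ k) !)
#permsWithPrefix {n} k S k≤n = begin
  ∑[ V ∈ allPerms n ] 𝟙 (does (prefix k V ≟ₛ S))                         ≡⟨ ∑-allPerms n _ ⟩
  ∑[ v ∈ allSeqs n n ] (𝟙 (isFresh ⊥ (toList v)) * 𝟙 (does (prefix k v ≟ₛ S)))
    ≡⟨ ∑-cong (allSeqs n n) (λ v → sym (𝟙-∧ (isFresh ⊥ (toList v)) _)) ⟩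
  ∑[ v ∈ allSeqs n n ] 𝟙 (isFresh ⊥ (toList v) ∧ does (prefix k v ≟ₛ S))
    ≡⟨ #freshWithPrefix n k ⊥ S k≤n (∣∁⊥∣≡n n) (λ y _ → lookup-⊥ y) ⟩
  𝟙 (∣ S ∣ ≡ᵇ k) * (k ! * (n ∸ k) !)                                     ∎
  where open ≡-Reasoning

countW≡∑ : ∀ {n} (W : Family n) k → countW W k ≡ ∑[ S ∈ allSubsets n ] 𝟙 (W S ∧ (∣ S ∣ ≡ᵇ k))
countW≡∑ {n} W k = begin
  countW W k
    ≡⟨ *-identityʳ _ ⟨
  countW W k * 1
    ≡⟨ ∑-const 1 (filter (λ S → 𝔹.T? (W S ∧ (∣ S ∣ ≡ᵇ k))) (allSubsets n)) ⟨
  ∑[ _ ∈ filter (λ S → 𝔹.T? (W S ∧ (∣ S ∣ ≡ᵇ k))) (allSubsets n) ] 1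
    ≡⟨ ∑-filter (λ S → 𝔹.T? (W S ∧ (∣ S ∣ ≡ᵇ k))) _ (allSubsets n) ⟩
  ∑[ S ∈ allSubsets n ] (𝟙 (W S ∧ (∣ S ∣ ≡ᵇ k)) * 1)
    ≡⟨ ∑-cong (allSubsets n) (λ S → *-identityʳ _) ⟩
  ∑[ S ∈ allSubsets n ] 𝟙 (W S ∧ (∣ S ∣ ≡ᵇ k)) ∎
  where open ≡-Reasoning

#permsWithWinningPrefix : ∀ {n} (W : Family n) k → k ≤ n →
                  ∑[ V ∈ allPerms n ] 𝟙 (W (prefix k V)) ≡ countW W k * (k ! * (n ∸ k) !)
#permsWithWinningPrefix {n} W k k≤n = begin
  ∑[ V ∈ allPerms n ] 𝟙 (W (prefix k V))
    ≡⟨ ∑-cong (allPerms n) (λ V → ∑-allSubsets-≟ (prefix k V) (𝟙 ∘ W)) ⟨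
  ∑[ V ∈ allPerms n ] ∑[ S ∈ allSubsets n ] (𝟙 (does (prefix k V ≟ₛ S)) * 𝟙 (W S))
    ≡⟨ ∑-comm _ (allPerms n) (allSubsets n) ⟩
  ∑[ S ∈ allSubsets n ] ∑[ V ∈ allPerms n ] (𝟙 (does (prefix k V ≟ₛ S)) * 𝟙 (W S))
    ≡⟨ ∑-cong (allSubsets n) (λ S → ∑-*ʳ (𝟙 (W S)) _ (allPerms n)) ⟩
  ∑[ S ∈ allSubsets n ] (∑[ V ∈ allPerms n ] 𝟙 (does (prefix k V ≟ₛ S)) * 𝟙 (W S))
    ≡⟨ ∑-cong (allSubsets n) (λ S → cong (_* 𝟙 (W S)) (#permsWithPrefix k S k≤n)) ⟩
  ∑[ S ∈ allSubsets n ] (𝟙 (∣ S ∣ ≡ᵇ k) * F * 𝟙 (W S))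
    ≡⟨ ∑-cong (allSubsets n) (λ S → rearrange (∣ S ∣ ≡ᵇ k) (W S)) ⟩
  ∑[ S ∈ allSubsets n ] (𝟙 (W S ∧ (∣ S ∣ ≡ᵇ k)) * F)
    ≡⟨ ∑-*ʳ F _ (allSubsets n) ⟩
  ∑[ S ∈ allSubsets n ] 𝟙 (W S ∧ (∣ S ∣ ≡ᵇ k)) * F
    ≡⟨ cong (_* F) (countW≡∑ W k) ⟨
  countW W k * F                                                          ∎
  where
  open ≡-Reasoning
  F : ℕ
  F = k ! * (n ∸ k) !
  rearrange : ∀ a b → 𝟙 a * F * 𝟙 b ≡ 𝟙 (b ∧ a) * F
  rearrange a true  = *-identityʳ _
  rearrange a false = *-zeroʳ (𝟙 a * F)

fromℚᵘ-homo-+ : ∀ p q → ℚ.fromℚᵘ p ℚ.+ ℚ.fromℚᵘ q ≡ ℚ.fromℚᵘ (p ℚᵘ.+ q)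
fromℚᵘ-homo-+ p q = ℚ.toℚᵘ-injective (ℚᵘ.≃-trans (ℚ.toℚᵘ-homo-+ (ℚ.fromℚᵘ p) (ℚ.fromℚᵘ q))
  (ℚᵘ.≃-trans (ℚᵘ.+-cong (ℚ.toℚᵘ-fromℚᵘ p) (ℚ.toℚᵘ-fromℚᵘ q)) (ℚᵘ.≃-sym (ℚ.toℚᵘ-fromℚᵘ (p ℚᵘ.+ q)))))

frac-cross : ∀ a b d e → a * suc e ≡ b * suc d → frac a (suc d) ≡ frac b (suc e)
frac-cross a b d e eq = ℚ.fromℚᵘ-cong {mkℚᵘ (ℤ.+ a) d} {mkℚᵘ (ℤ.+ b) e}
  (*≡* (trans (sym (ℤ.pos-* a (suc e))) (trans (cong ℤ.+_ eq) (ℤ.pos-* b (suc d)))))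

frac-+ : ∀ a b d → frac a (suc d) ℚ.+ frac b (suc d) ≡ frac (a + b) (suc d)
frac-+ a b d = trans (fromℚᵘ-homo-+ (mkℚᵘ (ℤ.+ a) d) (mkℚᵘ (ℤ.+ b) d))
  (ℚ.fromℚᵘ-cong {mkℚᵘ (ℤ.+ a) d ℚᵘ.+ mkℚᵘ (ℤ.+ b) d} {mkℚᵘ (ℤ.+ (a + b)) d} (*≡* same-denominator))
  where
  D = ℤ.+ suc d
  same-denominator : (ℤ.+ a ℤ.* D ℤ.+ ℤ.+ b ℤ.* D) ℤ.* D ≡ ℤ.+ (a + b) ℤ.* (D ℤ.* D)
  same-denominator = trans (cong (ℤ._* D) (sym (ℤ.*-distribʳ-+ D (ℤ.+ a) (ℤ.+ b)))) (ℤ.*-assoc (ℤ.+ (a + b)) D D)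

frac-∑ : ∀ {A : Set} (a : A → ℕ) d xs → sumℚ (map (λ x → frac (a x) (suc d)) xs) ≡ frac (∑ xs a) (suc d)
frac-∑ a d [] = sym (ℚ.0/n≡0 (suc d))
frac-∑ a d (x ∷ xs) = trans (cong (frac (a x) (suc d) ℚ.+_) (frac-∑ a d xs)) (frac-+ (a x) (∑ xs a) d)

frac-expand : ∀ a c f d → c * f ≡ suc d → frac a c ≡ frac (a * f) (suc d)
frac-expand a zero    f d ()
frac-expand a (suc c) f d c*f≡1+d = frac-cross a (a * f) c d (begin
  a * suc d            ≡⟨ cong (a *_) c*f≡1+d ⟨
  a * (suc c * f)      ≡⟨ cong (a *_) (*-comm (suc c) f) ⟩
  a * (f * suc c)      ≡⟨ *-assoc a f (suc c) ⟨
  a * f * suc c        ∎)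
  where open ≡-Reasoning

frac-whole : ∀ m d → frac m 1 ≡ frac (m * suc d) (suc d)
frac-whole m d = frac-cross m (m * suc d) 0 d (sym (*-identityʳ (m * suc d)))

p≡p+q-q : ∀ p q → p ≡ p ℚ.+ q ℚ.- q
p≡p+q-q p q = sym (trans (ℚ.+-assoc p q (ℚ.- q)) (trans (cong (p ℚ.+_) (ℚ.+-inverseʳ q)) (ℚ.+-identityʳ p)))

nCk*k!*[n∸k]!≡n! : ∀ {n k} → k ≤ n → (n C k) * (k ! * (n ∸ k) !) ≡ n !
nCk*k!*[n∸k]!≡n! {n} {k} k≤n =
  trans (cong (_* (k ! * (n ∸ k) !)) (nCk≡n!/k![n-k]! k≤n)) (m/n*n≡m {{k !* (n ∸ k) !≢0}} (k![n∸k]!∣n! k≤n))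

map-cong-upTo : ∀ {A : Set} {f g : ℕ → A} m → (∀ k → k < m → f k ≡ g k) → map f (upTo m) ≡ map g (upTo m)
map-cong-upTo m f≗g = map-cong-local (All.tabulate (λ {k} k∈ → f≗g k (∈-upTo⁻ k∈)))

𝟙-not+𝟙 : ∀ b → 𝟙 (not b) + 𝟙 b ≡ 1
𝟙-not+𝟙 true  = refl
𝟙-not+𝟙 false = refl

∑Q+∑winning≡[1+n]*n! : ∀ {n} (W : Family n) → IsMonotone W →
  ∑ (allPerms n) (Q W) + ∑[ k ∈ upTo (suc n) ] ∑[ V ∈ allPerms n ] 𝟙 (W (prefix k V)) ≡ suc n * n !
∑Q+∑winning≡[1+n]*n! {n} W mon = begin
  ∑ perms (Q W) + ∑[ k ∈ ks ] ∑[ V ∈ perms ] 𝟙 (wins V k)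
    ≡⟨ cong₂ _+_ (∑-cong perms (Q≡∑losing W mon)) (∑-comm _ ks perms) ⟩
  ∑[ V ∈ perms ] ∑[ k ∈ ks ] 𝟙 (not (wins V k)) + ∑[ V ∈ perms ] ∑[ k ∈ ks ] 𝟙 (wins V k)
    ≡⟨ ∑-+ (λ V → ∑[ k ∈ ks ] 𝟙 (not (wins V k))) (λ V → ∑[ k ∈ ks ] 𝟙 (wins V k)) perms ⟨
  ∑[ V ∈ perms ] (∑[ k ∈ ks ] 𝟙 (not (wins V k)) + ∑[ k ∈ ks ] 𝟙 (wins V k))
    ≡⟨ ∑-cong perms (λ V → sym (∑-+ (λ k → 𝟙 (not (wins V k))) (λ k → 𝟙 (wins V k)) ks)) ⟩
  ∑[ V ∈ perms ] ∑[ k ∈ ks ] (𝟙 (not (wins V k)) + 𝟙 (wins V k))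
    ≡⟨ ∑-cong perms (λ V → ∑-cong ks (λ k → 𝟙-not+𝟙 (wins V k))) ⟩
  ∑[ V ∈ perms ] ∑[ k ∈ ks ] 1
    ≡⟨ ∑-cong perms (λ V → trans (∑-const 1 ks) (cong (_* 1) (length-upTo (suc n)))) ⟩
  ∑[ V ∈ perms ] (suc n * 1)
    ≡⟨ ∑-const _ perms ⟩
  length perms * (suc n * 1)
    ≡⟨ cong₂ _*_ (length-allPerms n) (*-identityʳ (suc n)) ⟩
  n ! * suc n
    ≡⟨ *-comm (n !) (suc n) ⟩
  suc n * n !                                                                       ∎
  where
  open ≡-Reasoning
  perms : List (Vec (Fin n) n)
  perms = allPerms n
  ks : List ℕ
  ks = upTo (suc n)
  wins : Vec (Fin n) n → ℕ → Bool
  wins V k = W (prefix k V)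

countW/nCk≡#winning/n! : ∀ {n} (W : Family n) k d → n ! ≡ suc d → k ≤ n →
  frac (countW W k) (n C k) ≡ frac (∑[ V ∈ allPerms n ] 𝟙 (W (prefix k V))) (suc d)
countW/nCk≡#winning/n! {n} W k d n!≡1+d k≤n = begin
  frac (countW W k) (n C k)
    ≡⟨ frac-expand _ (n C k) _ d nCk*k!*[n∸k]!≡1+d ⟩
  frac (countW W k * (k ! * (n ∸ k) !)) (suc d)
    ≡⟨ cong (λ t → frac t (suc d)) (#permsWithWinningPrefix W k k≤n) ⟨
  frac (∑[ V ∈ allPerms n ] 𝟙 (W (prefix k V))) (suc d) ∎
  where
  open ≡-Reasoning
  nCk*k!*[n∸k]!≡1+d : (n C k) * (k ! * (n ∸ k) !) ≡ suc d
  nCk*k!*[n∸k]!≡1+d = trans (nCk*k!*[n∸k]!≡n! k≤n) n!≡1+d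

lemma2p7 : (n : ℕ) (W : Family n) → IsSimpleGame W → IsMonotone W → Qbar W ≡ rhs W
lemma2p7 n W _ mon = begin
  frac X (length (allPerms n))
    ≡⟨ cong (frac X) (trans (length-allPerms n) n!≡1+d) ⟩
  frac X (suc d)
    ≡⟨ p≡p+q-q (frac X (suc d)) (frac Y (suc d)) ⟩
  frac X (suc d) ℚ.+ frac Y (suc d) ℚ.- frac Y (suc d)
    ≡⟨ cong (ℚ._- frac Y (suc d)) (frac-+ X Y d) ⟩
  frac (X + Y) (suc d) ℚ.- frac Y (suc d)
    ≡⟨ cong (λ t → frac t (suc d) ℚ.- frac Y (suc d)) X+Y≡[1+n]*[1+d] ⟩
  frac (suc n * suc d) (suc d) ℚ.- frac Y (suc d)
    ≡⟨ cong₂ ℚ._-_ (frac-whole (suc n) d) ∑fracs≡Y/[1+d] ⟨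
  rhs W ∎
  where
  open ≡-Reasoning
  ks : List ℕ
  ks = upTo (suc n)
  -- frac computes only on a denominator of the form suc d.
  d : ℕ
  d = pred (n !)
  n!≡1+d : n ! ≡ suc d
  n!≡1+d = sym (suc-pred (n !) {{n !≢0}})
  #winning : ℕ → ℕ
  #winning k = ∑[ V ∈ allPerms n ] 𝟙 (W (prefix k V))
  X Y : ℕ
  X = ∑ (allPerms n) (Q W)
  Y = ∑ ks #winning
  X+Y≡[1+n]*[1+d] : X + Y ≡ suc n * suc d
  X+Y≡[1+n]*[1+d] = trans (∑Q+∑winning≡[1+n]*n! W mon) (cong (suc n *_) n!≡1+d)
  ∑fracs≡Y/[1+d] : sumℚ (map (λ k → frac (countW W k) (n C k)) ks) ≡ frac Y (suc d)
  ∑fracs≡Y/[1+d] = trans (cong sumℚ (map-cong-upTo (suc n) λ k k<1+n →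
                                       countW/nCk≡#winning/n! W k d n!≡1+d (≤-pred k<1+n)))
                         (frac-∑ #winning d ks)
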